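{- Let $X$ be a finite non-empty set and let $R\subseteq 2^X$ resolve $(2^X,\mathrm{Jac})$. Then (1) $R$ separates the distinct elements of $X$: for all distinct $x_1,x_2\in X$ there exists $r\in R$ containing exactly one of $x_1,x_2$; and (2) $R$ covers all but possibly one element of $X$: $\bigl|X\setminus \bigcup_{r\in R} r\bigr|\le 1$.
   Context: For a finite set $X$, $2^X$ is its power set. The Jaccard distance on $2^X$ is $\mathrm{Jac}(a,b)=|a\,\Delta\, b|/|a\cup b|$ for $a\neq b$ and $\mathrm{Jac}(a,a)=0$, where $\Delta$ is symmetric difference; it is a metric on $2^X$. A non-empty set $R\subseteq 2^X$ resolves $(2^X,\mathrm{Jac})$ if the map $a\mapsto (\mathrm{Jac}(a,r))_{r\in R}$ is injective on $2^X$. -}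

module Defs where

open import Data.Nat using (ℕ; zero; suc)
open import Data.Integer using (+_)
open import Data.Rational using (ℚ; 0ℚ; _/_)
open import Data.Fin using (Fin)
open import Data.Fin.Subset using (Subset; _∪_; _─_; ∣_∣; ∁; ⊥) renaming (_∈_ to _∈ₛ_)
open import Data.List using (List; foldr)
open import Data.Product using (∃; _×_)
open import Data.List.Membership.Propositional using (_∈_)
open import Relation.Binary.PropositionalEquality using (_≡_)

-- The ground set X is modelled as Fin n; 2^X is Subset n.

_Δ_ : ∀ {n} → Subset n → Subset n → Subset n
a Δ b = (a ─ b) ∪ (b ─ a)

-- Jaccard distance: |a Δ b| / |a ∪ b| (for a ≠ b, a ∪ b is non-empty);
-- when a ∪ b = ∅ we have a = b = ∅ and Jac = 0.
jacAux : ℕ → ℕ → ℚ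
jacAux num zero    = 0ℚ
jacAux num (suc k) = (+ num) / suc k

Jac : ∀ {n} → Subset n → Subset n → ℚ
Jac a b = jacAux ∣ a Δ b ∣ ∣ a ∪ b ∣

Resolves : ∀ {n} → List (Subset n) → Set
Resolves {n} R =
  (∃ λ r → r ∈ R) ×
  (∀ (a b : Subset n) → (∀ r → r ∈ R → Jac a r ≡ Jac b r) → a ≡ b)

uncovered : ∀ {n} → List (Subset n) → Subset n
uncovered R = ∁ (foldr _∪_ ⊥ R)

{-# OPTIONS --safe #-}
module Submission where

-- Both {x} ∪ r and {x} Δ r arise from r by overwriting its x-entry with a value
-- depending only on whether x ∈ r, so Jac({x}, r) depends only on r and that bit.
-- Hence if no r ∈ R separates x₁ ≠ x₂, the singletons {x₁} and {x₂} have equal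
-- coordinates, contradicting resolvability. Two uncovered points are such a pair.

open import Defs
open import Data.Bool using (Bool; true; false; _xor_)
import Data.Bool.Properties as Bool
open import Data.Empty using (⊥-elim)
open import Data.Fin using (Fin; zero; suc; _≟_)
import Data.Fin.Properties as Fin
open import Data.Fin.Subset
  using (Subset; ∣_∣; ⁅_⁆; _∪_; ⋃; _⊆_; Empty)
  renaming (_∈_ to _∈ₛ_; _∉_ to _∉ₛ_)
open import Data.Fin.Subset.Properties
  using (x∈⁅x⁆; x∈⁅y⁆⇒x≡y; x∈∁p⇒x∉p; p⊆p∪q; q⊆p∪q; ⊆-trans; Empty-unique; ∣⊥∣≡0)
open import Data.List using (List; _∷_)
open import Data.List.Membership.Propositional using (_∈_; find)
open import Data.List.Relation.Unary.All using (all?)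
import Data.List.Relation.Unary.All as All
open import Data.List.Relation.Unary.All.Properties using (¬All⇒Any¬)
import Data.List.Relation.Unary.Any as Any
open import Data.Nat using (ℕ; suc; _≤_; z≤n; s≤s)
open import Data.Nat.Properties using (suc-injective; ≤-reflexive)
open import Data.Product using (∃; _×_; _,_)
open import Data.Sum using (_⊎_; inj₁; inj₂)
open import Data.Vec using ([]; _∷_; lookup; zipWith; _[_]≔_; here; there)
open import Data.Vec.Properties using (zipWith-identityˡ; lookup⇒[]=; []=⇒lookup)
open import Algebra.Definitions using (LeftIdentity)
open import Relation.Nullary using (Dec; yes; no)
open import Relation.Binary.PropositionalEquality
  using (_≡_; _≢_; refl; sym; trans; cong; cong₂; subst; module ≡-Reasoning)

private
  variable
    n : ℕ

∣x∷y∷p∣≡∣y∷x∷p∣ : ∀ x y (p : Subset n) → ∣ x ∷ y ∷ p ∣ ≡ ∣ y ∷ x ∷ p ∣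
∣x∷y∷p∣≡∣y∷x∷p∣ true  true  p = refl
∣x∷y∷p∣≡∣y∷x∷p∣ true  false p = refl
∣x∷y∷p∣≡∣y∷x∷p∣ false true  p = refl
∣x∷y∷p∣≡∣y∷x∷p∣ false false p = refl

∣∷∣-cong : ∀ x {p q : Subset n} → ∣ p ∣ ≡ ∣ q ∣ → ∣ x ∷ p ∣ ≡ ∣ x ∷ q ∣
∣∷∣-cong true  eq = cong suc eq
∣∷∣-cong false eq = eq

∣∷∣-cancel : ∀ x {p q : Subset n} → ∣ x ∷ p ∣ ≡ ∣ x ∷ q ∣ → ∣ p ∣ ≡ ∣ q ∣
∣∷∣-cancel true  eq = suc-injective eq
∣∷∣-cancel false eq = eq

-- The extra head entry avoids truncated subtraction.
∣pᵢ∷p[i]≔x∣≡∣x∷p∣ : ∀ (p : Subset n) i x → ∣ lookup p i ∷ p [ i ]≔ x ∣ ≡ ∣ x ∷ p ∣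
∣pᵢ∷p[i]≔x∣≡∣x∷p∣ (y ∷ p) zero    x = ∣x∷y∷p∣≡∣y∷x∷p∣ y x p
∣pᵢ∷p[i]≔x∣≡∣x∷p∣ (y ∷ p) (suc i) x = begin
  ∣ lookup p i ∷ y ∷ p [ i ]≔ x ∣  ≡⟨ ∣x∷y∷p∣≡∣y∷x∷p∣ (lookup p i) y (p [ i ]≔ x) ⟩
  ∣ y ∷ lookup p i ∷ p [ i ]≔ x ∣  ≡⟨ ∣∷∣-cong y {lookup p i ∷ p [ i ]≔ x} {x ∷ p}
                                       (∣pᵢ∷p[i]≔x∣≡∣x∷p∣ p i x) ⟩
  ∣ y ∷ x ∷ p ∣                    ≡⟨ ∣x∷y∷p∣≡∣y∷x∷p∣ y x p ⟩
  ∣ x ∷ y ∷ p ∣                    ∎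
  where open ≡-Reasoning

∣p[i]≔x∣≡∣p[j]≔x∣ : ∀ (p : Subset n) {i j} x → lookup p i ≡ lookup p j →
                    ∣ p [ i ]≔ x ∣ ≡ ∣ p [ j ]≔ x ∣
∣p[i]≔x∣≡∣p[j]≔x∣ p {i} {j} x pᵢ≡pⱼ = ∣∷∣-cancel (lookup p i) {p [ i ]≔ x} {p [ j ]≔ x} (begin
  ∣ lookup p i ∷ p [ i ]≔ x ∣  ≡⟨ ∣pᵢ∷p[i]≔x∣≡∣x∷p∣ p i x ⟩
  ∣ x ∷ p ∣                    ≡⟨ sym (∣pᵢ∷p[i]≔x∣≡∣x∷p∣ p j x) ⟩
  ∣ lookup p j ∷ p [ j ]≔ x ∣  ≡⟨ cong (λ b → ∣ b ∷ p [ j ]≔ x ∣) (sym pᵢ≡pⱼ) ⟩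
  ∣ lookup p i ∷ p [ j ]≔ x ∣  ∎)
  where open ≡-Reasoning

module _ {f : Bool → Bool → Bool} (false-identityˡ : LeftIdentity _≡_ false f) where

  zipWith-⁅x⁆ : ∀ (x : Fin n) p → zipWith f ⁅ x ⁆ p ≡ p [ x ]≔ f true (lookup p x)
  zipWith-⁅x⁆ zero    (y ∷ p) = cong (f true y ∷_) (zipWith-identityˡ false-identityˡ p)
  zipWith-⁅x⁆ (suc x) (y ∷ p) = cong₂ _∷_ (false-identityˡ y) (zipWith-⁅x⁆ x p)

  ∣zipWith-⁅x⁆∣≡∣zipWith-⁅y⁆∣ : ∀ {x y : Fin n} p → lookup p x ≡ lookup p y →
                                ∣ zipWith f ⁅ x ⁆ p ∣ ≡ ∣ zipWith f ⁅ y ⁆ p ∣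
  ∣zipWith-⁅x⁆∣≡∣zipWith-⁅y⁆∣ {x = x} {y} p pₓ≡pᵧ = begin
    ∣ zipWith f ⁅ x ⁆ p ∣              ≡⟨ cong ∣_∣ (zipWith-⁅x⁆ x p) ⟩
    ∣ p [ x ]≔ f true (lookup p x) ∣   ≡⟨ cong (λ b → ∣ p [ x ]≔ f true b ∣) pₓ≡pᵧ ⟩
    ∣ p [ x ]≔ f true (lookup p y) ∣   ≡⟨ ∣p[i]≔x∣≡∣p[j]≔x∣ p _ pₓ≡pᵧ ⟩
    ∣ p [ y ]≔ f true (lookup p y) ∣   ≡⟨ cong ∣_∣ (sym (zipWith-⁅x⁆ y p)) ⟩
    ∣ zipWith f ⁅ y ⁆ p ∣              ∎
    where open ≡-Reasoning

Δ≡zipWith-xor : ∀ (p q : Subset n) → p Δ q ≡ zipWith _xor_ p q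
Δ≡zipWith-xor []          []          = refl
Δ≡zipWith-xor (true  ∷ p) (true  ∷ q) = cong (false ∷_) (Δ≡zipWith-xor p q)
Δ≡zipWith-xor (true  ∷ p) (false ∷ q) = cong (true  ∷_) (Δ≡zipWith-xor p q)
Δ≡zipWith-xor (false ∷ p) (true  ∷ q) = cong (true  ∷_) (Δ≡zipWith-xor p q)
Δ≡zipWith-xor (false ∷ p) (false ∷ q) = cong (false ∷_) (Δ≡zipWith-xor p q)

Jac-⁅x⁆≡Jac-⁅y⁆ : ∀ {x y : Fin n} r → lookup r x ≡ lookup r y → Jac ⁅ x ⁆ r ≡ Jac ⁅ y ⁆ r
Jac-⁅x⁆≡Jac-⁅y⁆ {x = x} {y} r rₓ≡rᵧ = cong₂ jacAux ∣Δ∣ ∣∪∣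
  where
  ∣Δ∣ : ∣ ⁅ x ⁆ Δ r ∣ ≡ ∣ ⁅ y ⁆ Δ r ∣
  ∣Δ∣ rewrite Δ≡zipWith-xor ⁅ x ⁆ r | Δ≡zipWith-xor ⁅ y ⁆ r =
    ∣zipWith-⁅x⁆∣≡∣zipWith-⁅y⁆∣ (λ _ → refl) r rₓ≡rᵧ
  ∣∪∣ : ∣ ⁅ x ⁆ ∪ r ∣ ≡ ∣ ⁅ y ⁆ ∪ r ∣
  ∣∪∣ = ∣zipWith-⁅x⁆∣≡∣zipWith-⁅y⁆∣ (λ _ → refl) r rₓ≡rᵧ

Separates : Subset n → Fin n → Fin n → Set
Separates r x y = (x ∈ₛ r × y ∉ₛ r) ⊎ (x ∉ₛ r × y ∈ₛ r)

lookup≡false⇒∉ : ∀ {r : Subset n} {x} → lookup r x ≡ false → x ∉ₛ r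
lookup≡false⇒∉ rₓ≡false x∈r with trans (sym ([]=⇒lookup x∈r)) rₓ≡false
... | ()

lookup-≢⇒Separates : ∀ (r : Subset n) {x y} → lookup r x ≢ lookup r y → Separates r x y
lookup-≢⇒Separates r {x} {y} rₓ≢rᵧ with lookup r x in rₓ≡ | lookup r y in rᵧ≡
... | true  | true  = ⊥-elim (rₓ≢rᵧ refl)
... | true  | false = inj₁ (lookup⇒[]= x r rₓ≡ , lookup≡false⇒∉ rᵧ≡)
... | false | true  = inj₂ (lookup≡false⇒∉ rₓ≡ , lookup⇒[]= y r rᵧ≡)
... | false | false = ⊥-elim (rₓ≢rᵧ refl)

⁅⁆-injective : ∀ {x y : Fin n} → ⁅ x ⁆ ≡ ⁅ y ⁆ → x ≡ y
⁅⁆-injective {x = x} {y} ⁅x⁆≡⁅y⁆ = x∈⁅y⁆⇒x≡y y (subst (x ∈ₛ_) ⁅x⁆≡⁅y⁆ (x∈⁅x⁆ x))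

agreeAt? : ∀ (x y : Fin n) (r : Subset n) → Dec (lookup r x ≡ lookup r y)
agreeAt? x y r = lookup r x Bool.≟ lookup r y

Resolves⇒Separates : ∀ {R : List (Subset n)} → Resolves R → ∀ {x y} → x ≢ y →
                     ∃ λ r → r ∈ R × Separates r x y
Resolves⇒Separates {R = R} (_ , resolve) {x} {y} x≢y
  with all? (agreeAt? x y) R
... | yes agree = ⊥-elim (x≢y (⁅⁆-injective (resolve ⁅ x ⁆ ⁅ y ⁆ sameCoordinates)))
  where
  sameCoordinates : ∀ r → r ∈ R → Jac ⁅ x ⁆ r ≡ Jac ⁅ y ⁆ r
  sameCoordinates r r∈R = Jac-⁅x⁆≡Jac-⁅y⁆ r (All.lookup agree r∈R)
... | no disagree with find (¬All⇒Any¬ (agreeAt? x y) R disagree)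
... | r , r∈R , rₓ≢rᵧ = r , r∈R , lookup-≢⇒Separates r rₓ≢rᵧ

⊆⋃ : ∀ {R : List (Subset n)} {r} → r ∈ R → r ⊆ ⋃ R
⊆⋃ {R = r ∷ R} (Any.here refl) = p⊆p∪q (⋃ R)
⊆⋃ {R = r ∷ R} (Any.there s∈R) = ⊆-trans (⊆⋃ s∈R) (q⊆p∪q r (⋃ R))

∈uncovered⇒∉ : ∀ {R : List (Subset n)} {r x} → x ∈ₛ uncovered R → r ∈ R → x ∉ₛ r
∈uncovered⇒∉ x∈U r∈R x∈r = x∈∁p⇒x∉p x∈U (⊆⋃ r∈R x∈r)

Subsingleton⇒∣p∣≤1 : ∀ (p : Subset n) → (∀ {x y} → x ∈ₛ p → y ∈ₛ p → x ≡ y) → ∣ p ∣ ≤ 1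
Subsingleton⇒∣p∣≤1 []          _      = z≤n
Subsingleton⇒∣p∣≤1 (false ∷ p) unique =
  Subsingleton⇒∣p∣≤1 p (λ x∈p y∈p → Fin.suc-injective (unique (there x∈p) (there y∈p)))
Subsingleton⇒∣p∣≤1 {suc n} (true ∷ p) unique =
  s≤s (≤-reflexive (trans (cong ∣_∣ (Empty-unique p-empty)) (∣⊥∣≡0 n)))
  where
  p-empty : Empty p
  p-empty (y , y∈p) with unique here (there y∈p)
  ... | ()

Resolves⇒∣uncovered∣≤1 : ∀ {R : List (Subset n)} → Resolves R → ∣ uncovered R ∣ ≤ 1
Resolves⇒∣uncovered∣≤1 {R = R} res = Subsingleton⇒∣p∣≤1 (uncovered R) unique
  where
  unique : ∀ {x y} → x ∈ₛ uncovered R → y ∈ₛ uncovered R → x ≡ y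
  unique {x} {y} x∈U y∈U with x ≟ y
  ... | yes x≡y = x≡y
  ... | no x≢y with Resolves⇒Separates res x≢y
  ...   | r , r∈R , inj₁ (x∈r , _) = ⊥-elim (∈uncovered⇒∉ x∈U r∈R x∈r)
  ...   | r , r∈R , inj₂ (_ , y∈r) = ⊥-elim (∈uncovered⇒∉ y∈U r∈R y∈r)

proposition1 : ∀ (n : ℕ) (R : List (Subset (suc n))) → Resolves R →
    (∀ (x₁ x₂ : Fin (suc n)) → x₁ ≢ x₂ →
      ∃ λ r → r ∈ R × ((x₁ ∈ₛ r × x₂ ∉ₛ r) ⊎ (x₁ ∉ₛ r × x₂ ∈ₛ r)))
    × ∣ uncovered R ∣ ≤ 1
proposition1 _ R res = (λ x₁ x₂ → Resolves⇒Separates res) , Resolves⇒∣uncovered∣≤1 res
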